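{- Let $X$ be a minimum zero forcing set of a graph $G=(V,E)$, let $T\subseteq V$ be nonempty, and let $G_T$ be the graph obtained by adding a new vertex $v^*$ to $G$ and joining it to all vertices in $T$. (1) If $T$ is a set of terminals of forcing chains associated with $X$ (i.e., there is a chronological list of forces for $X$ in $G$ in which every vertex of $T$ is a terminal of a forcing chain), then $X$ is a zero forcing set of $G_T$, and $Z(G_T;X)=Z(G)$. (2) If $X$ is a zero forcing set of $G_T$, then at least one vertex of $T$ is a terminal of a forcing chain associated with $X$ in $G$ (for some chronological list of forces for $X$ in $G$).
   Context: All graphs are finite, simple and undirected. Zero forcing: for a set of blue vertices (others white), if a blue vertex $u$ has exactly one white neighbor $w$, then $u$ forces $w$ (written $u\to w$) and $w$ becomes blue. $B$ is a zero forcing set if repeatedly applying this rule starting from $B$ colors all vertices; $Z(H)$ is the minimum size of a zero forcing set of $H$, and $Z(H;X)$ the minimum size of a zero forcing set of $H$ containing $X$. A chronological list of forces for $B$ is a sequence of forces applied, in order, to color all vertices starting from $B$. A forcing chain of such a list is a maximal sequence $(v_1,\ldots,v_k)$ with $v_i\to v_{i+1}$ in the list for $1\le i\le k-1$; its first vertex lies in $B$ and its last vertex $v_k$ is called its terminal (possibly $k=1$). Forcing chains of chronological lists for $B$ are said to be associated with $B$. -}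

module Defs where

open import Data.Nat using (ℕ; suc; _≤_)
open import Data.Bool using (Bool; true; false)
open import Data.Fin using (Fin; zero; suc)
open import Data.Fin.Subset using (Subset; _∈_; _∉_; _∪_; ⁅_⁆; ⊤; ∣_∣; _⊆_) public
open import Data.Fin.Subset.Properties using (_∈?_)
open import Data.Vec using (_∷_; lookup)
open import Data.Product using (Σ; ∃; _×_; _,_; proj₁)
open import Data.List using (List; []; _∷_)
open import Data.List.Relation.Unary.All using (All)
open import Relation.Binary.PropositionalEquality using (_≡_; _≢_)
open import Relation.Nullary using (yes; no)

record Graph (n : ℕ) : Set where
  field
    adj   : Fin n → Fin n → Bool
    sym   : ∀ u v → adj u v ≡ adj v u
    irrefl : ∀ u → adj u u ≡ false
open Graph public

Adj : ∀ {n} → Graph n → Fin n → Fin n → Set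
Adj G u v = adj G u v ≡ true

ValidForce : ∀ {n} → Graph n → Subset n → Fin n → Fin n → Set
ValidForce G S u w =
  u ∈ S × w ∉ S × Adj G u w × (∀ x → Adj G u x → x ≢ w → x ∈ S)

Force : ℕ → Set
Force n = Fin n × Fin n

data Run {n : ℕ} (G : Graph n) : Subset n → List (Force n) → Subset n → Set where
  done : ∀ {S} → Run G S [] S
  step : ∀ {S S' u w fs} → ValidForce G S u w →
         Run G (S ∪ ⁅ w ⁆) fs S' → Run G S ((u , w) ∷ fs) S'

ChronList : ∀ {n} → Graph n → Subset n → List (Force n) → Set
ChronList G B fs = Run G B fs ⊤

IsZFS : ∀ {n} → Graph n → Subset n → Set
IsZFS G B = ∃ λ fs → ChronList G B fs

-- v is the terminal of its forcing chain in the list fs: v performs no force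
-- (in a chronological list every vertex lies on exactly one chain, and the
-- last vertex of a maximal chain is exactly a vertex that forces nothing).
Terminal : ∀ {n} → List (Force n) → Fin n → Set
Terminal fs v = All (λ f → proj₁ f ≢ v) fs

IsMinZFS : ∀ {n} → Graph n → Subset n → Set
IsMinZFS G X = IsZFS G X × (∀ B → IsZFS G B → ∣ X ∣ ≤ ∣ B ∣)

HasZ : ∀ {n} → Graph n → ℕ → Set
HasZ G k = (∃ λ B → IsZFS G B × ∣ B ∣ ≡ k) × (∀ B → IsZFS G B → k ≤ ∣ B ∣)

HasZRel : ∀ {n} → Graph n → Subset n → ℕ → Set
HasZRel G X k =
  (∃ λ B → X ⊆ B × IsZFS G B × ∣ B ∣ ≡ k) × (∀ B → X ⊆ B → IsZFS G B → k ≤ ∣ B ∣)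

-- G_T : new vertex v* = zero, old vertex i becomes suc i; v* adjacent to T.
private
  memb : ∀ {n} → Fin n → Subset n → Bool
  memb i T with i ∈? T
  ... | yes _ = true
  ... | no _ = false

  adjT : ∀ {n} → Graph n → Subset n → Fin (suc n) → Fin (suc n) → Bool
  adjT G T zero zero = false
  adjT G T zero (suc j) = memb j T
  adjT G T (suc i) zero = memb i T
  adjT G T (suc i) (suc j) = adj G i j

  adjT-sym : ∀ {n} (G : Graph n) T u v → adjT G T u v ≡ adjT G T v u
  adjT-sym G T zero zero = _≡_.refl
  adjT-sym G T zero (suc j) = _≡_.refl
  adjT-sym G T (suc i) zero = _≡_.refl
  adjT-sym G T (suc i) (suc j) = sym G i j

  adjT-irr : ∀ {n} (G : Graph n) T u → adjT G T u u ≡ false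
  adjT-irr G T zero = _≡_.refl
  adjT-irr G T (suc i) = irrefl G i

addVertex : ∀ {n} → Graph n → Subset n → Graph (suc n)
addVertex G T = record { adj = adjT G T ; sym = adjT-sym G T ; irrefl = adjT-irr G T }

lift : ∀ {n} → Subset n → Subset (suc n)
lift X = false ∷ X

-- Part (1): if no vertex of T ever forces, every force of a chronological list for X in G is
-- still valid in G_T, because the only extra neighbour v* is adjacent to T alone; once V(G) is
-- blue, any vertex of T forces v*.  Part (2): in a chronological list for X in G_T, consider
-- the force t → v*.  Before it, v* is a white neighbour of every vertex of T, so no vertex of
-- T forces and the earlier forces form a run of G; when it happens, t ∈ T has all its
-- G-neighbours blue, so t never forces in any continuation of that run to all of V(G), which
-- exists because zero forcing is monotone.
module Submission where

open import Defs
open import Data.Nat using (ℕ; suc; _≤_)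
open import Data.Nat.Properties using (≤-antisym; ≤-trans)
open import Data.Fin using (Fin; zero; suc)
open import Data.Fin.Properties using (suc-injective)
open import Data.Fin.Subset using (Subset; Nonempty; inside)
open import Data.Fin.Subset.Properties
  using (_∈?_; p⊆p∪q; q⊆p∪q; x∈p∪q⁻; x∈⁅y⁆⇒x≡y; ∪-identityʳ; ∈⊤; ⊆⊤; ⊆-refl; ⊆-antisym;
         drop-there; p⊆q⇒∣p∣≤∣q∣)
open import Data.Vec using (there)
import Data.Vec as Vec
open import Data.List using (List; []; _∷_; _++_; map)
open import Data.List.Relation.Unary.All using (All; []; _∷_; tabulate; lookup)
open import Data.List.Relation.Unary.All.Properties using (++⁺)
open import Data.Product using (∃; ∃₂; _×_; _,_; proj₁)
import Data.Product as Product
open import Data.Sum using ([_,_])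
open import Data.Empty using (⊥-elim)
open import Relation.Nullary using (yes; no)
open import Relation.Binary.PropositionalEquality using (_≢_; refl; cong; subst)
  renaming (sym to ≡-sym)

private
  variable
    n : ℕ
    G : Graph n
    A A′ S S′ C : Subset n
    fs gs : List (Force n)

∪-lub : {p q r : Subset n} → p ⊆ r → q ⊆ r → p ∪ q ⊆ r
∪-lub {p = p} {q} p⊆r q⊆r x∈p∪q = [ p⊆r , q⊆r ] (x∈p∪q⁻ p q x∈p∪q)

∪-monoˡ-⊆ : {p q : Subset n} (r : Subset n) → p ⊆ q → p ∪ r ⊆ q ∪ r
∪-monoˡ-⊆ {q = q} r p⊆q = ∪-lub (λ x∈p → p⊆p∪q r (p⊆q x∈p)) (q⊆p∪q q r)

x∈p⇒⁅x⁆⊆p : {x : Fin n} {p : Subset n} → x ∈ p → ⁅ x ⁆ ⊆ p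
x∈p⇒⁅x⁆⊆p {x = x} {p} x∈p y∈⁅x⁆ = subst (_∈ p) (≡-sym (x∈⁅y⁆⇒x≡y x y∈⁅x⁆)) x∈p

Run-++ : Run G A fs S → Run G S gs C → Run G A (fs ++ gs) C
Run-++ done           r′ = r′
Run-++ (step force r) r′ = step force (Run-++ r r′)

Run-⊆ : Run G A fs S → A ⊆ S
Run-⊆ done               x∈A = x∈A
Run-⊆ (step {w = w} _ r) x∈A = Run-⊆ r (p⊆p∪q ⁅ w ⁆ x∈A)

-- A force u → w whose target is already blue in the larger set is skipped.
Run-mono : Run G A fs S → A ⊆ A′ → ∃₂ λ fs′ S′ → Run G A′ fs′ S′ × S ⊆ S′
Run-mono {A′ = A′} done A⊆A′ = [] , A′ , done , A⊆A′
Run-mono {A′ = A′} (step {w = w} _ r) A⊆A′ with w ∈? A′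
... | yes w∈A′ = Run-mono r (∪-lub A⊆A′ (x∈p⇒⁅x⁆⊆p w∈A′))
Run-mono {A′ = A′} (step {u = u} {w} (u∈A , _ , uw , others) r) A⊆A′ | no w∉A′
  with Run-mono r (∪-monoˡ-⊆ ⁅ w ⁆ A⊆A′)
... | fs′ , S′ , r′ , S⊆S′ =
  (u , w) ∷ fs′ , S′ ,
  step (A⊆A′ u∈A , w∉A′ , uw , λ x ux x≢w → A⊆A′ (others x ux x≢w)) r′ ,
  S⊆S′

IsZFS-mono : IsZFS G A → A ⊆ A′ → IsZFS G A′
IsZFS-mono (_ , r) A⊆A′ with Run-mono r A⊆A′
... | fs′ , _ , r′ , ⊤⊆S′ = fs′ , subst (Run _ _ fs′) (⊆-antisym ⊆⊤ ⊤⊆S′) r′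

NeighboursIn : Graph n → Fin n → Subset n → Set
NeighboursIn G t S = ∀ x → Adj G t x → x ∈ S

NeighboursIn⇒Terminal : ∀ {t} → NeighboursIn G t S → Run G S fs S′ → Terminal fs t
NeighboursIn⇒Terminal N[t]⊆S done = []
NeighboursIn⇒Terminal N[t]⊆S (step {w = w} (_ , w∉S , uw , _) r) =
  (λ { refl → w∉S (N[t]⊆S w uw) }) ∷
  NeighboursIn⇒Terminal (λ x tx → p⊆p∪q ⁅ w ⁆ (N[t]⊆S x tx)) r

Terminals⇒forcers∉ : {T : Subset n} →
  (∀ t → t ∈ T → Terminal fs t) → All (λ f → proj₁ f ∉ T) fs
Terminals⇒forcers∉ terminal = tabulate λ f∈fs u∈T → lookup (terminal _ u∈T) f∈fs refl

module Apex (G : Graph n) (T : Subset n) where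

  Gᵀ : Graph (suc n)
  Gᵀ = addVertex G T

  adj-apex⇒∈ : ∀ u → Adj Gᵀ (suc u) zero → u ∈ T
  adj-apex⇒∈ u _ with u ∈? T
  ... | yes u∈T = u∈T
  adj-apex⇒∈ u () | no _

  ∈⇒adj-apex : ∀ {u} → u ∈ T → Adj Gᵀ (suc u) zero
  ∈⇒adj-apex {u} u∈T with u ∈? T
  ... | yes _   = refl
  ... | no u∉T = ⊥-elim (u∉T u∈T)

  liftForces : List (Force n) → List (Force (suc n))
  liftForces = map (Product.map suc suc)

  ValidForce-lift : ∀ {u w} → u ∉ T → ValidForce G S u w → ValidForce Gᵀ (lift S) (suc u) (suc w)
  ValidForce-lift {S = S} {u} {w} u∉T (u∈S , w∉S , uw , others) =
    there u∈S , (λ w∈S → w∉S (drop-there w∈S)) , uw , others*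
    where
    others* : ∀ x → Adj Gᵀ (suc u) x → x ≢ suc w → x ∈ lift S
    others* zero    ux _   = ⊥-elim (u∉T (adj-apex⇒∈ u ux))
    others* (suc x) ux x≢w = there (others x ux (λ x≡w → x≢w (cong suc x≡w)))

  Run-lift : Run G A fs S → All (λ f → proj₁ f ∉ T) fs → Run Gᵀ (lift A) (liftForces fs) (lift S)
  Run-lift done          []           = done
  Run-lift (step force r) (u∉T ∷ u∉Ts) = step (ValidForce-lift u∉T force) (Run-lift r u∉Ts)

  apex-forced : ∀ {t} → t ∈ T → Run Gᵀ (lift ⊤) ((suc t , zero) ∷ []) ⊤
  apex-forced {t} t∈T =
    step (there ∈⊤ , (λ ()) , ∈⇒adj-apex t∈T , all-blue)
         (subst (λ S → Run Gᵀ S [] ⊤) (cong (inside Vec.∷_) (≡-sym (∪-identityʳ ⊤))) done)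
    where
    all-blue : ∀ x → Adj Gᵀ (suc t) x → x ≢ zero → x ∈ lift ⊤
    all-blue zero    _ x≢0 = ⊥-elim (x≢0 refl)
    all-blue (suc x) _ _   = there ∈⊤

  -- While v* is white, a vertex of T can force only v*.
  forcer∉T : ∀ {u w} → ValidForce Gᵀ (lift S) (suc u) (suc w) → u ∉ T
  forcer∉T (_ , _ , _ , others) u∈T with others zero (∈⇒adj-apex u∈T) (λ ())
  ... | ()

  ValidForce-unlift : ∀ {u w} → ValidForce Gᵀ (lift S) (suc u) (suc w) → ValidForce G S u w
  ValidForce-unlift (u∈S , w∉S , uw , others) =
    drop-there u∈S , (λ w∈S → w∉S (there w∈S)) , uw ,
    λ x ux x≢w → drop-there (others (suc x) ux (λ sx≡sw → x≢w (suc-injective sx≡sw)))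

  Run-until-apex : ∀ {gs} → Run Gᵀ (lift A) gs ⊤ →
    ∃₂ λ fs S → Run G A fs S × ∃ λ t → t ∈ T × Terminal fs t × NeighboursIn G t S
  Run-until-apex (step {u = zero} (() , _) _)
  Run-until-apex {A = A} (step {u = suc t} {w = zero} (_ , _ , t∼v* , others) _) =
    [] , A , done , t , adj-apex⇒∈ t t∼v* , [] ,
    λ x tx → drop-there (others (suc x) tx (λ ()))
  Run-until-apex (step {u = suc u} {w = suc w} force r) with Run-until-apex r
  ... | fs , S , r′ , t , t∈T , terminal , N[t]⊆S =
    (u , w) ∷ fs , S , step (ValidForce-unlift force) r′ ,
    t , t∈T , (λ { refl → forcer∉T force t∈T }) ∷ terminal , N[t]⊆S

  HasZRel-lift : ∀ {X k} → IsMinZFS G X → IsZFS Gᵀ (lift X) → HasZ G k → HasZRel Gᵀ (lift X) k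
  HasZRel-lift {X} (X-zfs , X-min) liftX-zfs ((B , B-zfs , ∣B∣≡k) , Z≤) =
    (lift X , ⊆-refl , liftX-zfs , ≤-antisym (subst (∣ X ∣ ≤_) ∣B∣≡k (X-min B B-zfs)) (Z≤ X X-zfs)) ,
    λ B′ liftX⊆B′ _ → ≤-trans (Z≤ X X-zfs) (p⊆q⇒∣p∣≤∣q∣ liftX⊆B′)

proposition4p6 : ∀ {n} (G : Graph n) (X T : Subset n) →
    IsMinZFS G X → Nonempty T →
    ((∃ λ (fs : List (Force n)) → ChronList G X fs × (∀ t → t ∈ T → Terminal fs t)) →
      IsZFS (addVertex G T) (lift X) × (∀ k → HasZ G k → HasZRel (addVertex G T) (lift X) k))
    × (IsZFS (addVertex G T) (lift X) →
      ∃ λ (fs : List (Force n)) → ChronList G X fs × ∃ λ t → t ∈ T × Terminal fs t)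
proposition4p6 G X T X-min (t₀ , t₀∈T) = part₁ , part₂
  where
  open Apex G T
  part₁ : (∃ λ fs → ChronList G X fs × (∀ t → t ∈ T → Terminal fs t)) →
    IsZFS Gᵀ (lift X) × (∀ k → HasZ G k → HasZRel Gᵀ (lift X) k)
  part₁ (fs , chron , terminal) = liftX-zfs , λ _ → HasZRel-lift X-min liftX-zfs
    where
    liftX-zfs : IsZFS Gᵀ (lift X)
    liftX-zfs = liftForces fs ++ (suc t₀ , zero) ∷ [] ,
      Run-++ (Run-lift chron (Terminals⇒forcers∉ terminal)) (apex-forced t₀∈T)

  part₂ : IsZFS Gᵀ (lift X) → ∃ λ fs → ChronList G X fs × ∃ λ t → t ∈ T × Terminal fs t
  part₂ (_ , r) with Run-until-apex r
  ... | fs , S , r′ , t , t∈T , terminal , N[t]⊆S with IsZFS-mono (proj₁ X-min) (Run-⊆ r′)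
  ... | fs′ , r″ =
    fs ++ fs′ , Run-++ r′ r″ , t , t∈T , ++⁺ terminal (NeighboursIn⇒Terminal N[t]⊆S r″)
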